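{- If $G$ is a graph, then $\gamma(G\circ K_1)<\gamma_{\rm cer}(G\circ K_1)$.
   Context: All graphs are finite and simple with nonempty vertex set. The corona $G\circ K_1$ is the graph obtained from $G$ by attaching, for each vertex $v$ of $G$, a new vertex adjacent only to $v$ (a pendant edge at each vertex). A dominating set of a graph $H$ is a set $D\subseteq V_H$ such that every vertex of $V_H-D$ has a neighbor in $D$; $\gamma(H)$ is the minimum cardinality of a dominating set. A certified dominating set of $H$ is a dominating set $D$ such that every vertex in $D$ has either zero or at least two neighbors in $V_H-D$; $\gamma_{\rm cer}(H)$ is its minimum cardinality. -}

module Defs where

open import Level using (0ℓ)
open import Data.Nat using (ℕ; _≤_; _<_; _+_)
open import Data.Fin using (Fin; splitAt)
open import Data.Fin.Subset using (Subset; _∈_; _∉_; ∣_∣)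
open import Data.Sum using (_⊎_; inj₁; inj₂)
open import Data.Product using (Σ; _×_; ∃; ∃-syntax)
open import Data.Empty using (⊥)
open import Relation.Nullary using (¬_)
open import Relation.Binary.PropositionalEquality using (_≡_)

record Graph (n : ℕ) : Set₁ where
  field
    Adj   : Fin n → Fin n → Set
    sym   : ∀ {u v} → Adj u v → Adj v u
    irrefl : ∀ {v} → ¬ Adj v v
open Graph public

-- Adjacency of the corona G ∘ K₁ on Fin (n + n):
-- the first n vertices are the vertices of G, vertex n + i is the pendant vertex attached to i.
coronaAdj' : ∀ {n} → Graph n → Fin n ⊎ Fin n → Fin n ⊎ Fin n → Set
coronaAdj' G (inj₁ u) (inj₁ v) = Adj G u v
coronaAdj' G (inj₁ u) (inj₂ v) = u ≡ v
coronaAdj' G (inj₂ u) (inj₁ v) = u ≡ v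
coronaAdj' G (inj₂ u) (inj₂ v) = ⊥

corona : ∀ {n} → Graph n → Graph (n + n)
corona {n} G = record
  { Adj = λ u v → coronaAdj' G (splitAt n u) (splitAt n v)
  ; sym = λ {u} {v} → s (splitAt n u) (splitAt n v)
  ; irrefl = λ {v} → i (splitAt n v)
  }
  where
  open import Relation.Binary.PropositionalEquality using (refl)
  s : ∀ a b → coronaAdj' G a b → coronaAdj' G b a
  s (inj₁ u) (inj₁ v) p = Graph.sym G p
  s (inj₁ u) (inj₂ v) refl = refl
  s (inj₂ u) (inj₁ v) refl = refl
  s (inj₂ u) (inj₂ v) ()
  i : ∀ a → ¬ coronaAdj' G a a
  i (inj₁ u) p = Graph.irrefl G p
  i (inj₂ u) ()

IsDominating : ∀ {m} → Graph m → Subset m → Set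
IsDominating H D = ∀ v → v ∉ D → ∃[ u ] (u ∈ D × Adj H u v)

IsCertified : ∀ {m} → Graph m → Subset m → Set
IsCertified H D = ∀ v → v ∈ D →
  (∀ u → u ∉ D → ¬ Adj H v u)
  ⊎ (∃[ u ] ∃[ w ] (u ∉ D × w ∉ D × Adj H v u × Adj H v w × ¬ u ≡ w))

IsCertifiedDominating : ∀ {m} → Graph m → Subset m → Set
IsCertifiedDominating H D = IsDominating H D × IsCertified H D

IsMinCard : ∀ {m} → (Subset m → Set) → ℕ → Set
IsMinCard P k = (∃[ D ] (P D × ∣ D ∣ ≡ k)) × (∀ D → P D → k ≤ ∣ D ∣)

IsDominationNumber : ∀ {m} → Graph m → ℕ → Set
IsDominationNumber H = IsMinCard (IsDominating H)

IsCertifiedDominationNumber : ∀ {m} → Graph m → ℕ → Set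
IsCertifiedDominationNumber H = IsMinCard (IsCertifiedDominating H)

module Submission where

-- In G ∘ K₁ every vertex v of G has a private pendant neighbour v′, so a dominating set meets
-- each of the n pairs {v, v′}; G itself is such a set, whence γ = n. For a certified dominating
-- set D, a pendant in D whose partner is outside would have exactly one neighbour outside D,
-- and a pendant outside D forces its partner in; hence D ⊇ V(G). Then a base vertex whose pendant
-- is outside D has that pendant as its only outside neighbour, so D is everything: γ_cer = 2n.

open import Defs hiding (sym)
open import Data.Nat using (_<_; _≤_; _+_; suc; z≤n; s≤s)
import Data.Nat.Properties
open import Data.Nat.Properties using (≤-trans; +-suc; +-monoʳ-≤; +-identityʳ; m<m+n)
open import Data.Product using (∃-syntax; _×_; _,_)
open import Data.Sum using (_⊎_; inj₁; inj₂)
open import Data.Empty using (⊥-elim)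
open import Data.Fin using (Fin; _↑ˡ_; _↑ʳ_; splitAt)
open import Data.Fin.Properties using (splitAt-↑ˡ; splitAt-↑ʳ; splitAt⁻¹-↑ˡ; splitAt⁻¹-↑ʳ)
open import Data.Fin.Subset using (Subset; _∈_; _∉_; _∪_; _⊆_; ∣_∣; ⊤; inside; outside)
  renaming (⊥ to ∅)
open import Data.Fin.Subset.Properties
  using (_∈?_; ∈⊤; ∣⊤∣≡n; ∣⊥∣≡0; ∣p∣≤∣x∷p∣; p⊆q⇒∣p∣≤∣q∣; x∈p∪q⁺)
open import Data.Vec using ([]; _∷_; _++_)
import Data.Vec as Vec
open import Data.Vec.Properties using (lookup-++ˡ; lookup-++ʳ; lookup⇒[]=; []=⇒lookup)
open import Relation.Nullary using (¬_; yes; no)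
open import Relation.Binary.PropositionalEquality
  using (_≡_; refl; sym; trans; cong; cong₂; subst; module ≡-Reasoning)

∣p++q∣≡∣p∣+∣q∣ : ∀ {m n} (p : Subset m) (q : Subset n) → ∣ p ++ q ∣ ≡ ∣ p ∣ + ∣ q ∣
∣p++q∣≡∣p∣+∣q∣ []            q = refl
∣p++q∣≡∣p∣+∣q∣ (inside ∷ p)  q = cong suc (∣p++q∣≡∣p∣+∣q∣ p q)
∣p++q∣≡∣p∣+∣q∣ (outside ∷ p) q = ∣p++q∣≡∣p∣+∣q∣ p q

∣p∪q∣≤∣p∣+∣q∣ : ∀ {m} (p q : Subset m) → ∣ p ∪ q ∣ ≤ ∣ p ∣ + ∣ q ∣
∣p∪q∣≤∣p∣+∣q∣ []            []            = z≤n
∣p∪q∣≤∣p∣+∣q∣ (inside ∷ p)  (x ∷ q)       =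
  s≤s (≤-trans (∣p∪q∣≤∣p∣+∣q∣ p q) (+-monoʳ-≤ ∣ p ∣ (∣p∣≤∣x∷p∣ x q)))
∣p∪q∣≤∣p∣+∣q∣ (outside ∷ p) (inside ∷ q)  =
  subst (suc ∣ p ∪ q ∣ ≤_) (sym (+-suc ∣ p ∣ ∣ q ∣)) (s≤s (∣p∪q∣≤∣p∣+∣q∣ p q))
∣p∪q∣≤∣p∣+∣q∣ (outside ∷ p) (outside ∷ q) = ∣p∪q∣≤∣p∣+∣q∣ p q

module _ {m n} {p : Subset m} {q : Subset n} where

  ∈++⁻ˡ : ∀ {i} → i ↑ˡ n ∈ p ++ q → i ∈ p
  ∈++⁻ˡ {i} h = lookup⇒[]= i p (trans (sym (lookup-++ˡ p q i)) ([]=⇒lookup h))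

  ∈++⁻ʳ : ∀ {i} → m ↑ʳ i ∈ p ++ q → i ∈ q
  ∈++⁻ʳ {i} h = lookup⇒[]= i q (trans (sym (lookup-++ʳ p q i)) ([]=⇒lookup h))

  ∈++⁺ˡ : ∀ {i} → i ∈ p → i ↑ˡ n ∈ p ++ q
  ∈++⁺ˡ {i} h = lookup⇒[]= (i ↑ˡ n) (p ++ q) (trans (lookup-++ˡ p q i) ([]=⇒lookup h))

∣⊤++∅∣≡n : ∀ n → ∣ ⊤ {n} ++ ∅ {n} ∣ ≡ n
∣⊤++∅∣≡n n = begin
  ∣ ⊤ {n} ++ ∅ {n} ∣       ≡⟨ ∣p++q∣≡∣p∣+∣q∣ (⊤ {n}) (∅ {n}) ⟩
  ∣ ⊤ {n} ∣ + ∣ ∅ {n} ∣    ≡⟨ cong₂ _+_ (∣⊤∣≡n n) (∣⊥∣≡0 n) ⟩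
  n + 0                    ≡⟨ +-identityʳ n ⟩
  n                        ∎
  where open ≡-Reasoning

module _ {m} (H : Graph m) {D : Subset m} where

  dominator-of-sole-neighbour : IsDominating H D → ∀ {u v} → v ∉ D →
    (∀ w → Adj H w v → w ≡ u) → u ∈ D
  dominator-of-sole-neighbour dom v∉D sole with dom _ v∉D
  ... | w , w∈D , w~v = subst (_∈ D) (sole w w~v) w∈D

  ¬certified-sole-outside-neighbour : IsCertified H D → ∀ {u v} → v ∈ D → u ∉ D → Adj H v u →
    ¬ (∀ w → w ∉ D → Adj H v w → w ≡ u)
  ¬certified-sole-outside-neighbour cert v∈D u∉D v~u sole with cert _ v∈D
  ... | inj₁ none = none _ u∉D v~u
  ... | inj₂ (w , w′ , w∉D , w′∉D , v~w , v~w′ , w≢w′) =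
    w≢w′ (trans (sole w w∉D v~w) (sym (sole w′ w′∉D v~w′)))

⊤-isCertifiedDominating : ∀ {m} (H : Graph m) → IsCertifiedDominating H ⊤
⊤-isCertifiedDominating H = (λ _ v∉⊤ → ⊥-elim (v∉⊤ ∈⊤)) , (λ _ _ → inj₁ (λ _ u∉⊤ _ → u∉⊤ ∈⊤))

module Corona {n} (G : Graph n) where

  H : Graph (n + n)
  H = corona G

  data CoronaVertex : Fin (n + n) → Set where
    base    : ∀ i → CoronaVertex (i ↑ˡ n)
    pendant : ∀ i → CoronaVertex (n ↑ʳ i)

  coronaVertex : ∀ v → CoronaVertex v
  coronaVertex v with splitAt n v in eq
  ... | inj₁ i = subst CoronaVertex (splitAt⁻¹-↑ˡ eq) (base i)
  ... | inj₂ i = subst CoronaVertex (splitAt⁻¹-↑ʳ eq) (pendant i)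

  base~pendant : ∀ i → Adj H (i ↑ˡ n) (n ↑ʳ i)
  base~pendant i rewrite splitAt-↑ˡ n i n | splitAt-↑ʳ n n i = refl

  base~pendant⇒≡ : ∀ {i j} → Adj H (i ↑ˡ n) (n ↑ʳ j) → i ≡ j
  base~pendant⇒≡ {i} {j} i~j rewrite splitAt-↑ˡ n i n | splitAt-↑ʳ n n j = i~j

  pendant-neighbour≡base : ∀ {i w} → Adj H (n ↑ʳ i) w → w ≡ i ↑ˡ n
  pendant-neighbour≡base {i} {w} i~w with coronaVertex w
  ... | base j = cong (_↑ˡ n) (base~pendant⇒≡ (Graph.sym H i~w))
  ... | pendant j rewrite splitAt-↑ʳ n n i | splitAt-↑ʳ n n j = ⊥-elim i~w

  module _ {D : Subset (n + n)} where

    dominating⇒base∈⊎pendant∈ : IsDominating H D → ∀ i → i ↑ˡ n ∈ D ⊎ n ↑ʳ i ∈ D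
    dominating⇒base∈⊎pendant∈ dom i with n ↑ʳ i ∈? D
    ... | yes pendant∈D = inj₂ pendant∈D
    ... | no pendant∉D  = inj₁ (dominator-of-sole-neighbour H dom pendant∉D
                                  (λ _ w~pendant → pendant-neighbour≡base (Graph.sym H w~pendant)))

    certifiedDominating⇒base∈ : IsCertifiedDominating H D → ∀ i → i ↑ˡ n ∈ D
    certifiedDominating⇒base∈ (dom , cert) i with dominating⇒base∈⊎pendant∈ dom i | i ↑ˡ n ∈? D
    ... | inj₁ base∈D       | _          = base∈D
    ... | inj₂ _            | yes base∈D = base∈D
    ... | inj₂ pendant∈D    | no base∉D  = ⊥-elim
      (¬certified-sole-outside-neighbour H cert pendant∈D base∉D (Graph.sym H (base~pendant i))
        (λ _ _ → pendant-neighbour≡base))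

    certifiedDominating⇒pendant∈ : IsCertifiedDominating H D → ∀ i → n ↑ʳ i ∈ D
    certifiedDominating⇒pendant∈ cd@(_ , cert) i with n ↑ʳ i ∈? D
    ... | yes pendant∈D = pendant∈D
    ... | no pendant∉D  = ⊥-elim
      (¬certified-sole-outside-neighbour H cert (base∈ i) pendant∉D (base~pendant i) sole)
      where
      base∈ : ∀ j → j ↑ˡ n ∈ D
      base∈ = certifiedDominating⇒base∈ cd

      sole : ∀ w → w ∉ D → Adj H (i ↑ˡ n) w → w ≡ n ↑ʳ i
      sole w w∉D i~w with coronaVertex w
      ... | base j    = ⊥-elim (w∉D (base∈ j))
      ... | pendant j = cong (n ↑ʳ_) (sym (base~pendant⇒≡ i~w))

    certifiedDominating⇒⊤⊆ : IsCertifiedDominating H D → ⊤ ⊆ D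
    certifiedDominating⇒⊤⊆ cd {v} _ with coronaVertex v
    ... | base i    = certifiedDominating⇒base∈ cd i
    ... | pendant i = certifiedDominating⇒pendant∈ cd i

  dominating⇒n≤∣D∣ : ∀ D → IsDominating H D → n ≤ ∣ D ∣
  dominating⇒n≤∣D∣ D dom with Vec.splitAt n D
  ... | p , q , refl = begin
    n               ≡⟨ sym (∣⊤∣≡n n) ⟩
    ∣ ⊤ {n} ∣       ≤⟨ p⊆q⇒∣p∣≤∣q∣ {p = ⊤} (λ {i} _ → x∈p∪q⁺ (covered i)) ⟩
    ∣ p ∪ q ∣       ≤⟨ ∣p∪q∣≤∣p∣+∣q∣ p q ⟩
    ∣ p ∣ + ∣ q ∣   ≡⟨ sym (∣p++q∣≡∣p∣+∣q∣ p q) ⟩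
    ∣ p ++ q ∣      ∎
    where
    open Data.Nat.Properties.≤-Reasoning
    covered : ∀ i → i ∈ p ⊎ i ∈ q
    covered i with dominating⇒base∈⊎pendant∈ dom i
    ... | inj₁ base∈D    = inj₁ (∈++⁻ˡ base∈D)
    ... | inj₂ pendant∈D = inj₂ (∈++⁻ʳ pendant∈D)

  base∈⊤++∅ : ∀ i → i ↑ˡ n ∈ ⊤ {n} ++ ∅ {n}
  base∈⊤++∅ i = ∈++⁺ˡ {p = ⊤} {q = ∅} ∈⊤

  base-isDominating : IsDominating H (⊤ {n} ++ ∅ {n})
  base-isDominating v v∉D with coronaVertex v
  ... | base i    = ⊥-elim (v∉D (base∈⊤++∅ i))
  ... | pendant i = i ↑ˡ n , base∈⊤++∅ i , base~pendant i

  dominationNumber-n : IsDominationNumber H n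
  dominationNumber-n = (⊤ {n} ++ ∅ {n} , base-isDominating , ∣⊤++∅∣≡n n) , dominating⇒n≤∣D∣

  certifiedDominationNumber≡n+n : IsCertifiedDominationNumber H (n + n)
  certifiedDominationNumber≡n+n =
    (⊤ , ⊤-isCertifiedDominating H , ∣⊤∣≡n (n + n)) ,
    λ D cd → subst (_≤ ∣ D ∣) (∣⊤∣≡n (n + n)) (p⊆q⇒∣p∣≤∣q∣ (certifiedDominating⇒⊤⊆ cd))

corollary2p13 : ∀ {n} → 1 ≤ n → (G : Graph n) →
    ∃[ a ] ∃[ b ] (IsDominationNumber (corona G) a × IsCertifiedDominationNumber (corona G) b × a < b)
corollary2p13 {n} 1≤n G = n , n + n , dominationNumber-n , certifiedDominationNumber≡n+n , m<m+n n 1≤n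
  where open Corona G
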